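{- Let $n\ge 6$ and let $u$ be a sequence on $n$ distinct letters such that every letter occurs at least twice, $fw(u)=4$, $u$ has alternation length $5$, and the first $n$ letters of $u$ are $1\,2\ldots n$. If the last letter of $u$ is $1$ and the middle letter of $u$ is $2$, then the second-to-last letter of $u$ is $2$ or $n$.
   Context: A sequence $s$ contains $u$ if some (not necessarily contiguous) subsequence of $s$ can be changed into $u$ by a one-to-one renaming of letters. An $(r,s)$-formation is a concatenation of $s$ permutations, each of the same set of $r$ distinct letters. The formation width $fw(u)$ is the minimum $s$ such that there exists $r$ for which every $(r,s)$-formation contains $u$. A sequence has alternation length $5$ if it contains $ababa$ (for distinct letters $a,b$) but does not contain $ababab$. Every sequence satisfying the hypotheses has length $2n+1$; its middle letter is its $(n+1)$-st letter. -}

module Defs where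

open import Data.Nat using (ℕ; zero; suc; _≤_; _<_)
open import Data.Nat.Properties using (_≟_)
open import Data.Fin using (Fin)
open import Data.List using (List; []; _∷_; map; concat; length; filter; take; drop; head; reverse; upTo; tabulate)
open import Data.List.Membership.Propositional using (_∈_)
open import Data.List.Relation.Unary.Unique.Propositional using (Unique)
open import Data.List.Relation.Binary.Sublist.Propositional using (_⊆_)
open import Data.List.Relation.Binary.Permutation.Propositional using (_↭_)
open import Data.Product using (Σ; ∃; _×_; _,_)
open import Relation.Binary.PropositionalEquality using (_≡_)
open import Relation.Nullary using (¬_)

Seq : Set
Seq = List ℕ

Contains : Seq → Seq → Set
Contains s u =
  Σ Seq λ v → (v ⊆ s) ×
    Σ (ℕ → ℕ) λ f →
      (∀ {x y} → x ∈ v → y ∈ v → f x ≡ f y → x ≡ y) × (map f v ≡ u)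

IsFormation : ℕ → ℕ → Seq → Set
IsFormation r s w =
  Σ Seq λ L → Unique L × (length L ≡ r) ×
    Σ (Fin s → Seq) λ p → (∀ i → p i ↭ L) × (w ≡ concat (tabulate p))

AllFormationsContain : ℕ → ℕ → Seq → Set
AllFormationsContain r s u = ∀ w → IsFormation r s w → Contains w u

FormationWidth : Seq → ℕ → Set
FormationWidth u k =
  (∃ λ r → AllFormationsContain r k u) ×
  (∀ s → s < k → ¬ (∃ λ r → AllFormationsContain r s u))

-- alternation length 5: contains ababa but not ababab
-- (injectivity of the renaming forces a ≠ b)
AlternationLength5 : Seq → Set
AlternationLength5 u =
  Contains u (0 ∷ 1 ∷ 0 ∷ 1 ∷ 0 ∷ []) ×
  ¬ Contains u (0 ∷ 1 ∷ 0 ∷ 1 ∷ 0 ∷ 1 ∷ [])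

occ : ℕ → Seq → ℕ
occ x u = length (filter (_≟ x) u)

-- Write u = 1 2 ⋯ n 2 M x 1.  A letter other than 1, 2, x occurs once in the prefix and at
-- least twice in u, hence in M.
-- A pattern contained in u is contained in every (r,4)-formation, in particular in every
-- concatenation of four increasing or decreasing runs of 0 ⋯ r-1; whether a pattern fits
-- such a monotone formation is decided by a finite search for a split into runs whose order
-- constraints are acyclic.  Patterns failing that test rule out x = 1, and for 3 ≤ x < n they
-- force 1, 2, x ∉ M and M nondecreasing.  Then neither the increasing prefix nor the suffix
-- 2 M x 1 contains a pattern a b a with a ≠ b, so u avoids ababa: alternation length 5 fails.
module Submission where

open import Defs
open import Data.Bool using (Bool; false; T; not)
open import Data.Bool.ListAction using (any)
open import Data.Bool.Properties using (T-not-≡)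
open import Data.Empty using (⊥; ⊥-elim)
import Data.List as List
open import Data.List
  using (List; []; _∷_; [_]; _++_; map; length; concat; filter; tabulate; applyUpTo;
         upTo; downFrom; take; drop; head; reverse; initLast; _∷ʳ′_)
open import Data.List.Properties
  using (map-∘; map-id-local; map-++; map-applyUpTo; tabulate-lookup; map-tabulate; length-upTo;
         reverse-upTo; reverse-++; ++-assoc; filter-++; length-++; filter-accept; filter-reject; filter-none)
open import Data.List.Membership.Propositional using (_∈_; _∉_; lose)
open import Data.List.Membership.Propositional.Properties
  using (∈-map⁺; ∈-map⁻; ∈-++⁺ˡ; ∈-++⁺ʳ; ∈-++⁻; ∈-filter⁻)
open import Data.List.Relation.Unary.All as All using (All; []; _∷_; all?)
open import Data.List.Relation.Unary.All.Properties using (++⁺; ++⁻ˡ; ++⁻ʳ)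
open import Data.List.Relation.Unary.Any as Any using (Any; here; there; any?)
open import Data.List.Relation.Unary.Any.Properties using (any⁺)
open import Data.List.Relation.Unary.AllPairs as AllPairs using (AllPairs; []; _∷_)
open import Data.List.Relation.Unary.AllPairs.Properties using (applyUpTo⁺₁; applyDownFrom⁺₁)
open import Data.List.Relation.Unary.Unique.Propositional.Properties using (upTo⁺)
open import Data.List.Relation.Binary.Pointwise using (≡⇒Pointwise-≡; []; _∷_)
open import Data.List.Relation.Binary.Sublist.Propositional
  using (_⊆_; []; _∷_; _∷ʳ_; lookup; minimum; from∈; ⊆-refl; ⊆-trans)
open import Data.List.Relation.Binary.Sublist.Propositional.Properties
  using (All-resp-⊆; length-mono-≤; ∷ˡ⁻)
  renaming (++⁺ to ⊆-++⁺)
open import Data.List.Relation.Binary.Permutation.Propositional using (_↭_; ↭-refl)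
open import Data.List.Relation.Binary.Permutation.Propositional.Properties using (↭-reverse)
open import Data.Maybe using (just)
open import Data.Nat using (ℕ; zero; suc; _+_; _<_; _≤_; _≤?_; _≟_; z≤n; s≤s)
open import Data.List.Membership.DecPropositional _≟_ using (_∈?_)
open import Data.Nat.Properties
  using (≤-refl; ≤-trans; ≤-antisym; ≤-pred; <-irrefl; <-trans; <-cmp; ≤-<-trans; <⇒≤; <⇒≢; >⇒≢;
         ≮⇒≥; ≤∧≢⇒<; 0≢1+n; m≤m+n; module ≤-Reasoning; m≤n⇒m≤1+n; +-suc; +-identityʳ; +-monoˡ-≤)
open import Data.Product using (∃; ∃₂; _×_; _,_; proj₁; proj₂)
import Data.Product as Product
open import Data.Sum as Sum using (_⊎_; inj₁; inj₂; [_,_]′)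
open import Function using (_∘_; id; case_of_; Equivalence)
open import Relation.Binary using (tri<; tri≈; tri>)
open import Relation.Binary.PropositionalEquality
  using (_≡_; _≢_; ≢-sym; refl; sym; trans; cong; cong₂; subst; subst₂)
open import Relation.Nullary using (¬_; Dec; yes; no; does; contradiction)
open import Relation.Nullary.Decidable using (True; toWitness; dec-false; _×-dec_)

private variable
  A : Set
  a b c : A
  xs ys : List A

⊆-++-split : ∀ (ys : List A) {zs xs} → xs ⊆ ys ++ zs →
             ∃₂ λ p q → xs ≡ p ++ q × p ⊆ ys × q ⊆ zs
⊆-++-split []       τ          = [] , _ , refl , [] , τ
⊆-++-split (y ∷ ys) (.y ∷ʳ τ)
  with p , q , refl , τ₁ , τ₂ ← ⊆-++-split ys τ = p , q , refl , y ∷ʳ τ₁ , τ₂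
⊆-++-split (y ∷ ys) (refl ∷ τ)
  with p , q , refl , τ₁ , τ₂ ← ⊆-++-split ys τ = y ∷ p , q , refl , refl ∷ τ₁ , τ₂

AllPairs-resp-⊆ : ∀ {R : A → A → Set} → xs ⊆ ys → AllPairs R ys → AllPairs R xs
AllPairs-resp-⊆ []         []         = []
AllPairs-resp-⊆ (y ∷ʳ τ)   (_ ∷ Rys)  = AllPairs-resp-⊆ τ Rys
AllPairs-resp-⊆ (refl ∷ τ) (Ry ∷ Rys) = All-resp-⊆ τ Ry ∷ AllPairs-resp-⊆ τ Rys

⊆-insert : xs ⊆ ys → c ∈ ys → c ∉ xs → ∃₂ λ p q → xs ≡ p ++ q × p ++ c ∷ q ⊆ ys
⊆-insert (y ∷ʳ τ)   (here refl) _   = [] , _ , refl , refl ∷ τ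
⊆-insert (refl ∷ τ) (here refl) c∉ = ⊥-elim (c∉ (here refl))
⊆-insert (y ∷ʳ τ)   (there c∈) c∉
  with p , q , refl , σ ← ⊆-insert τ c∈ c∉ = p , q , refl , y ∷ʳ σ
⊆-insert (refl ∷ τ) (there c∈) c∉
  with p , q , refl , σ ← ⊆-insert τ c∈ (c∉ ∘ there) = _ ∷ p , q , refl , refl ∷ σ

⊆-insert-singleton : [ a ] ⊆ ys → c ∈ ys → c ≢ a →
                     c ∷ a ∷ [] ⊆ ys ⊎ a ∷ c ∷ [] ⊆ ys
⊆-insert-singleton τ c∈ c≢a with ⊆-insert τ c∈ (λ { (here c≡a) → c≢a c≡a })
... | []    , _  , refl , σ = inj₁ σ
... | _ ∷ [] , [] , refl , σ = inj₂ σ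

⊆-insert-pair : a ∷ b ∷ [] ⊆ ys → c ∈ ys → c ≢ a → c ≢ b →
                c ∷ a ∷ b ∷ [] ⊆ ys ⊎ a ∷ c ∷ b ∷ [] ⊆ ys ⊎ a ∷ b ∷ c ∷ [] ⊆ ys
⊆-insert-pair τ c∈ c≢a c≢b
  with ⊆-insert τ c∈ (λ { (here c≡a) → c≢a c≡a ; (there (here c≡b)) → c≢b c≡b })
... | []         , _  , refl , σ = inj₁ σ
... | _ ∷ []     , _  , refl , σ = inj₂ (inj₁ σ)
... | _ ∷ _ ∷ [] , [] , refl , σ = inj₂ (inj₂ σ)

ABAFree : List A → Set
ABAFree xs = ∀ {a b} → a ∷ b ∷ a ∷ [] ⊆ xs → a ≡ b

short⇒ABAFree : length xs ≤ 2 → ABAFree xs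
short⇒ABAFree ≤2 τ with ≤-trans (length-mono-≤ τ) ≤2
... | s≤s (s≤s ())

pairwise-≤⇒ABAFree : {xs : List ℕ} → (∀ {a b} → a ∷ b ∷ [] ⊆ xs → a ≤ b) → ABAFree xs
pairwise-≤⇒ABAFree ordered τ =
  ≤-antisym (ordered (⊆-trans (refl ∷ refl ∷ _ ∷ʳ []) τ))
            (ordered (⊆-trans (_ ∷ʳ refl ∷ refl ∷ []) τ))

ABAFree-++ : ABAFree xs → ABAFree ys → (∀ {c} → c ∈ xs → c ∉ ys) → ABAFree (xs ++ ys)
ABAFree-++ {xs = xs} free₁ free₂ disjoint τ with ⊆-++-split xs τ
... | []             , _  , refl , _ , σ = free₂ σ
... | _ ∷ []         , _  , refl , ρ , σ =
  ⊥-elim (disjoint (lookup ρ (here refl)) (lookup σ (there (here refl))))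
... | _ ∷ _ ∷ []     , _  , refl , ρ , σ =
  ⊥-elim (disjoint (lookup ρ (here refl)) (lookup σ (here refl)))
... | _ ∷ _ ∷ _ ∷ [] , [] , refl , ρ , _ = free₁ ρ

ababa-split : a ∷ b ∷ a ∷ b ∷ a ∷ [] ⊆ xs ++ ys → a ∷ b ∷ a ∷ [] ⊆ xs ⊎ a ∷ b ∷ a ∷ [] ⊆ ys
ababa-split {xs = xs} τ with ⊆-++-split xs τ
... | []                     , _  , refl , _ , σ = inj₂ (∷ˡ⁻ (∷ˡ⁻ σ))
... | _ ∷ []                 , _  , refl , _ , σ = inj₂ (∷ˡ⁻ σ)
... | _ ∷ _ ∷ []             , _  , refl , _ , σ = inj₂ σ
... | _ ∷ _ ∷ _ ∷ []         , _  , refl , ρ , _ = inj₁ ρ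
... | _ ∷ _ ∷ _ ∷ _ ∷ []     , _  , refl , ρ , _ = inj₁ (⊆-trans (refl ∷ refl ∷ refl ∷ _ ∷ʳ []) ρ)
... | _ ∷ _ ∷ _ ∷ _ ∷ _ ∷ [] , [] , refl , ρ , _ = inj₁ (⊆-trans (refl ∷ refl ∷ refl ∷ _ ∷ʳ _ ∷ʳ []) ρ)

ababa : Seq
ababa = 0 ∷ 1 ∷ 0 ∷ 1 ∷ 0 ∷ []

InjectiveOn : (ℕ → ℕ) → List ℕ → Set
InjectiveOn f v = ∀ {x y} → x ∈ v → y ∈ v → f x ≡ f y → x ≡ y

ababa-shape : ∀ {f} v → InjectiveOn f v → map f v ≡ ababa →
              ∃₂ λ a b → a ≢ b × v ≡ a ∷ b ∷ a ∷ b ∷ a ∷ []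
ababa-shape (a ∷ b ∷ c ∷ d ∷ e ∷ []) inj eq
  with fa ∷ fb ∷ fc ∷ fd ∷ fe ∷ [] ← ≡⇒Pointwise-≡ eq
  with refl ← inj (there (there (here refl))) (here refl) (trans fc (sym fa))
     | refl ← inj (there (there (there (here refl)))) (there (here refl)) (trans fd (sym fb))
     | refl ← inj (there (there (there (there (here refl))))) (here refl) (trans fe (sym fa))
  = a , b , (λ { refl → 0≢1+n (trans (sym fa) fb) }) , refl

no-ababa-in-++ : {xs ys : Seq} → ABAFree xs → ABAFree ys → ¬ Contains (xs ++ ys) ababa
no-ababa-in-++ free₁ free₂ (v , τ , f , inj , eq) with ababa-shape v inj eq
... | a , b , a≢b , refl = a≢b ([ free₁ , free₂ ]′ (ababa-split τ))

preimage : (ℕ → ℕ) → List ℕ → ℕ → ℕ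
preimage g []       y = 0
preimage g (x ∷ xs) y with g x ≟ y
... | yes _ = x
... | no _  = preimage g xs y

preimage-inverse : ∀ g xs → InjectiveOn g xs → ∀ {e} → e ∈ xs → preimage g xs (g e) ≡ e
preimage-inverse g (x ∷ xs) inj {e} e∈ with g x ≟ g e | e∈
... | yes gx≡ge | _          = inj (here refl) e∈ gx≡ge
... | no gx≢ge  | here refl  = ⊥-elim (gx≢ge refl)
... | no _      | there e∈xs = preimage-inverse g xs (λ p q → inj (there p) (there q)) e∈xs

⊆-map-preimage : ∀ (f : ℕ → ℕ) v {w} → w ⊆ map f v → ∃ λ v′ → v′ ⊆ v × map f v′ ≡ w
⊆-map-preimage f []      []         = [] , [] , refl
⊆-map-preimage f (c ∷ v) (.(f c) ∷ʳ τ)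
  with v′ , σ , eq ← ⊆-map-preimage f v τ = v′ , c ∷ʳ σ , eq
⊆-map-preimage f (c ∷ v) (refl ∷ τ)
  with v′ , σ , refl ← ⊆-map-preimage f v τ = c ∷ v′ , refl ∷ σ , refl

Contains-trans : ∀ {w u q} → Contains w u → Contains u q → Contains w q
Contains-trans (v , τ , f , f-inj , refl) (_ , σ , g , g-inj , refl)
  with v′ , ρ , refl ← ⊆-map-preimage f v σ =
  v′ , ⊆-trans ρ τ , g ∘ f , inj , map-∘ v′
  where
  inj : InjectiveOn (g ∘ f) v′
  inj x∈ y∈ eq = f-inj (lookup ρ x∈) (lookup ρ y∈) (g-inj (∈-map⁺ f x∈) (∈-map⁺ f y∈) eq)

Contains-image : ∀ {u} q (g : ℕ → ℕ) → InjectiveOn g q → map g q ⊆ u → Contains u q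
Contains-image q g g-inj τ =
  map g q , τ , preimage g q , inj ,
  trans (sym (map-∘ q)) (map-id-local (All.tabulate (preimage-inverse g q g-inj)))
  where
  inj : InjectiveOn (preimage g q) (map g q)
  inj x∈ y∈ eq with ∈-map⁻ g x∈ | ∈-map⁻ g y∈
  ... | x , x∈q , refl | y , y∈q , refl =
    cong g (trans (sym (preimage-inverse g q g-inj x∈q)) (trans eq (preimage-inverse g q g-inj y∈q)))

data Direction : Set where
  ↑ ↓ : Direction

run : Direction → ℕ → List ℕ
run ↑ = upTo
run ↓ = downFrom

Precedes : Direction → ℕ → ℕ → Set
Precedes ↑ a b = a < b
Precedes ↓ a b = b < a

run-sorted : ∀ d r → AllPairs (Precedes d) (run d r)
run-sorted ↑ r = applyUpTo⁺₁ id r (λ i<j _ → i<j)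
run-sorted ↓ r = applyDownFrom⁺₁ id r (λ j<i _ → j<i)

run↭upTo : ∀ d r → run d r ↭ upTo r
run↭upTo ↑ r = ↭-refl
run↭upTo ↓ r = subst (_↭ upTo r) (reverse-upTo r) (↭-reverse (upTo r))

monotoneFormation : List Direction → ℕ → Seq
monotoneFormation ds r = concat (map (λ d → run d r) ds)

monotoneFormation-isFormation : ∀ ds r → IsFormation r (length ds) (monotoneFormation ds r)
monotoneFormation-isFormation ds r =
  upTo r , upTo⁺ r , length-upTo r , block , (λ i → run↭upTo (List.lookup ds i) r) , cong concat blocks
  where
  block = λ i → run (List.lookup ds i) r
  blocks : map (λ d → run d r) ds ≡ tabulate block
  blocks = trans (cong (map _) (sym (tabulate-lookup ds))) (map-tabulate (List.lookup ds) _)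

Constraint : Set
Constraint = ℕ × ℕ

Respects : (ℕ → ℕ) → Constraint → Set
Respects val (a , b) = val a < val b

Satisfies : (ℕ → ℕ) → List Constraint → Set
Satisfies val = All (Respects val)

oriented : Direction → ℕ → ℕ → Constraint
oriented ↑ a b = a , b
oriented ↓ a b = b , a

constraints : Direction → List ℕ → List Constraint
constraints d (a ∷ b ∷ cs) = oriented d a b ∷ constraints d (b ∷ cs)
constraints d _            = []

oriented-respects : ∀ d {val a b} → Precedes d (val a) (val b) → Respects val (oriented d a b)
oriented-respects ↑ a<b = a<b
oriented-respects ↓ b<a = b<a

successors : List Constraint → List ℕ → List ℕ
successors []            S = []
successors ((a , b) ∷ E) S with a ∈? S
... | yes _ = b ∷ successors E S
... | no _  = successors E S

reachable : ℕ → List Constraint → List ℕ → List ℕ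
reachable zero    E S = S
reachable (suc k) E S = reachable k E (S ++ successors E S)

Cyclic : List Constraint → Set
Cyclic E = Any (λ a → a ∈ reachable (length E) E (successors E [ a ])) (map proj₁ E)

cyclic? : ∀ E → Dec (Cyclic E)
cyclic? E = any? (λ a → a ∈? reachable (length E) E (successors E [ a ])) (map proj₁ E)

successors-above : ∀ {val E m S} → Satisfies val E → All (λ b → m ≤ val b) S →
                   All (λ b → m < val b) (successors E S)
successors-above []                         _  = []
successors-above {E = (a , _) ∷ _} {S = S} (a<b ∷ sat) S≥ with a ∈? S
... | yes a∈S = ≤-<-trans (All.lookup S≥ a∈S) a<b ∷ successors-above sat S≥
... | no _    = successors-above sat S≥

reachable-above : ∀ k {val E m S} → Satisfies val E → All (λ b → m < val b) S →
                  All (λ b → m < val b) (reachable k E S)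
reachable-above zero    sat S> = S>
reachable-above (suc k) sat S> = reachable-above k sat (++⁺ S> (successors-above sat (All.map <⇒≤ S>)))

satisfiable⇒acyclic : ∀ {val E} → Satisfies val E → ¬ Cyclic E
satisfiable⇒acyclic {E = E} sat cycle with a , a∈ ← Any.satisfied cycle =
  <-irrefl refl (All.lookup (reachable-above (length E) sat (successors-above sat (≤-refl ∷ []))) a∈)

splits : List ℕ → List (List ℕ × List ℕ)
splits []       = ([] , []) ∷ []
splits (x ∷ xs) = ([] , x ∷ xs) ∷ map (Product.map₁ (x ∷_)) (splits xs)

∈-splits : ∀ p q → (p , q) ∈ splits (p ++ q)
∈-splits []      []      = here refl
∈-splits []      (_ ∷ _) = here refl
∈-splits (x ∷ p) q       = there (∈-map⁺ (Product.map₁ (x ∷_)) (∈-splits p q))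

fits : List Direction → List Constraint → List ℕ → Bool
fits []       E []      = not (does (cyclic? E))
fits []       E (_ ∷ _) = false
fits (d ∷ ds) E Q       = any (λ (p , q) → fits ds (constraints d p ++ E) q) (splits Q)

constraints-satisfied : ∀ d {h val} v → (∀ {e} → e ∈ v → val (h e) ≡ e) →
                        AllPairs (Precedes d) v → Satisfies val (constraints d (map h v))
constraints-satisfied d []          _   _ = []
constraints-satisfied d (_ ∷ [])    _   _ = []
constraints-satisfied d {val = val} (a ∷ b ∷ v) inv ((a≺b ∷ _) ∷ sorted) =
  oriented-respects d {val} (subst₂ (Precedes d) (sym (inv (here refl))) (sym (inv (there (here refl)))) a≺b) ∷
  constraints-satisfied d (b ∷ v) (inv ∘ there) sorted

fits-embedding : ∀ ds r {E v h val} → v ⊆ monotoneFormation ds r → (∀ {e} → e ∈ v → val (h e) ≡ e) →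
                 Satisfies val E → T (fits ds E (map h v))
fits-embedding []       r {E} {[]} [] _ sat =
  Equivalence.from T-not-≡ (dec-false (cyclic? E) (satisfiable⇒acyclic sat))
fits-embedding (d ∷ ds) r {h = h} τ inv sat
  with p , q , refl , τ₁ , τ₂ ← ⊆-++-split (run d r) τ rewrite map-++ h p q =
  any⁺ _ (lose (∈-splits (map h p) (map h q)) (fits-embedding ds r τ₂ (inv ∘ ∈-++⁺ʳ p) sat′))
  where
  sat′ = ++⁺ (constraints-satisfied d p (inv ∘ ∈-++⁺ˡ) (AllPairs-resp-⊆ τ₁ (run-sorted d r))) sat

contained⇒fits : ∀ ds r {Q} → Contains (monotoneFormation ds r) Q → T (fits ds [] Q)
contained⇒fits ds r (v , τ , h , inj , refl) =
  fits-embedding ds r {val = preimage h v} τ (preimage-inverse h v inj) []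

interval : ℕ → ℕ → List ℕ
interval m zero    = []
interval m (suc k) = m ∷ interval (suc m) k

applyUpTo≡interval : ∀ {f} m k → (∀ i → f i ≡ m + i) → applyUpTo f k ≡ interval m k
applyUpTo≡interval m zero    f≗ = refl
applyUpTo≡interval m (suc k) f≗ =
  cong₂ _∷_ (trans (f≗ 0) (+-identityʳ m))
            (applyUpTo≡interval (suc m) k (λ i → trans (f≗ (suc i)) (+-suc m i)))

data Ascending (lo hi : ℕ) : List ℕ → Set where
  []  : lo ≤ hi → Ascending lo hi []
  _∷_ : ∀ {x xs} → lo ≤ x → Ascending (suc x) hi xs → Ascending lo hi (x ∷ xs)

Ascending-bounded : ∀ {lo hi xs} → Ascending lo hi xs → lo ≤ hi
Ascending-bounded ([] lo≤hi)  = lo≤hi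
Ascending-bounded (lo≤x ∷ xs) = ≤-trans lo≤x (<⇒≤ (Ascending-bounded xs))

Ascending-lower : ∀ {lo hi xs} → Ascending lo hi xs → All (lo ≤_) xs
Ascending-lower ([] _)      = []
Ascending-lower (lo≤x ∷ xs) = lo≤x ∷ All.map (≤-trans lo≤x ∘ <⇒≤) (Ascending-lower xs)

Ascending⇒AllPairs : ∀ {lo hi xs} → Ascending lo hi xs → AllPairs _<_ xs
Ascending⇒AllPairs ([] _)     = []
Ascending⇒AllPairs (_ ∷ xs) = Ascending-lower xs ∷ Ascending⇒AllPairs xs

interval-ascending : ∀ m k → Ascending m (m + k) (interval m k)
interval-ascending m zero    = [] (m≤m+n m 0)
interval-ascending m (suc k) =
  ≤-refl ∷ subst (λ h → Ascending (suc m) h (interval (suc m) k)) (sym (+-suc m k))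
                 (interval-ascending (suc m) k)

Ascending⊆interval : ∀ {m} k {xs} → Ascending m (m + k) xs → xs ⊆ interval m k
Ascending⊆interval zero    ([] _)      = []
Ascending⊆interval {m} zero (m≤x ∷ xs) =
  ⊥-elim (<-irrefl refl (≤-trans (s≤s m≤x) (subst (_ ≤_) (+-identityʳ m) (Ascending-bounded xs))))
Ascending⊆interval (suc k) ([] _)      = minimum _
Ascending⊆interval {m} (suc k) {x ∷ xs} (m≤x ∷ asc) with m ≟ x
... | yes refl = refl ∷ Ascending⊆interval k asc′
  where asc′ = subst (λ h → Ascending (suc m) h xs) (+-suc m k) asc
... | no m≢x   = m ∷ʳ Ascending⊆interval k (≤∧≢⇒< m≤x m≢x ∷ asc′)
  where asc′ = subst (λ h → Ascending (suc x) h xs) (+-suc m k) asc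

occ-++ : ∀ c xs ys → occ c (xs ++ ys) ≡ occ c xs + occ c ys
occ-++ c xs ys = trans (cong length (filter-++ (_≟ c) xs ys)) (length-++ (filter (_≟ c) xs))

occ-unique : ∀ {c xs} → AllPairs _≢_ xs → occ c xs ≤ 1
occ-unique [] = z≤n
occ-unique {c} {x ∷ xs} (x∉xs ∷ unique) with x ≟ c
... | yes refl rewrite filter-accept (_≟ c) {xs = xs} refl
                     | filter-none (_≟ c) (All.map ≢-sym x∉xs) = s≤s z≤n
... | no x≢c   rewrite filter-reject (_≟ c) {xs = xs} x≢c = occ-unique unique

occ-positive⇒∈ : ∀ {c} xs → 1 ≤ occ c xs → c ∈ xs
occ-positive⇒∈ {c} xs pos with filter (_≟ c) xs in eq
... | y ∷ _ with y∈xs , refl ← ∈-filter⁻ (_≟ c) {xs = xs} (subst (y ∈_) (sym eq) (here refl)) = y∈xs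

second-occurrence : ∀ {c xs} ys → AllPairs _≢_ xs → 2 ≤ occ c (xs ++ ys) → c ∈ ys
second-occurrence {c} {xs} ys unique twice = occ-positive⇒∈ ys (≤-pred (begin
  2                   ≤⟨ twice ⟩
  occ c (xs ++ ys)    ≡⟨ occ-++ c xs ys ⟩
  occ c xs + occ c ys ≤⟨ +-monoˡ-≤ (occ c ys) (occ-unique unique) ⟩
  1 + occ c ys        ∎))
  where open ≤-Reasoning

realise : List ℕ → ℕ → ℕ
realise (l ∷ _)  1             = l
realise (_ ∷ ls) (suc (suc j)) = realise ls (suc j)
realise _        _             = 0

InRange : ℕ → ℕ → Set
InRange k j = 1 ≤ j × j ≤ k

realise-∈ : ∀ ls {j} → InRange (length ls) j → realise ls j ∈ ls
realise-∈ (l ∷ ls) {1}           _              = here refl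
realise-∈ (l ∷ ls) {suc (suc j)} (_ , s≤s j≤k) = there (realise-∈ ls (s≤s z≤n , j≤k))

realise-injective : ∀ {ls} → AllPairs _≢_ ls → ∀ {i j} → InRange (length ls) i → InRange (length ls) j →
                    realise ls i ≡ realise ls j → i ≡ j
realise-injective {l ∷ ls} (l∉ls ∷ _) {1} {1} _ _ _ = refl
realise-injective {l ∷ ls} (l∉ls ∷ _) {1} {suc (suc j)} _ (_ , s≤s j≤k) eq =
  ⊥-elim (All.lookup l∉ls (realise-∈ ls (s≤s z≤n , j≤k)) eq)
realise-injective {l ∷ ls} (l∉ls ∷ _) {suc (suc i)} {1} (_ , s≤s i≤k) _ eq =
  ⊥-elim (All.lookup l∉ls (realise-∈ ls (s≤s z≤n , i≤k)) (sym eq))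
realise-injective {l ∷ ls} (_ ∷ unique) {suc (suc i)} {suc (suc j)} (_ , s≤s i≤k) (_ , s≤s j≤k) eq =
  cong suc (realise-injective unique (s≤s z≤n , i≤k) (s≤s z≤n , j≤k) eq)

interval-ABAFree : ∀ m k → ABAFree (interval m k)
interval-ABAFree m k = pairwise-≤⇒ABAFree λ σ →
  case AllPairs-resp-⊆ σ (Ascending⇒AllPairs (interval-ascending m k)) of λ where
    ((a<b ∷ []) ∷ _) → <⇒≤ a<b

module LastLetters (n : ℕ) (M : List ℕ) (x : ℕ) {r : ℕ}
  (width4 : AllFormationsContain r 4 (interval 1 n ++ 2 ∷ M ++ x ∷ 1 ∷ []))
  (M-bounded : All (λ c → 1 ≤ c × c ≤ n) M)
  (M-complete : ∀ {c} → 1 ≤ c → c ≤ n → c ≢ 1 → c ≢ 2 → c ≢ x → c ∈ M) where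

  -- The word contains Q, realised by the letters 1 ∷ 2 ∷ Ls of the prefix and Mp of M, so Q
  -- would fit the monotone formation with runs d₁ ⋯ d₄.  The implicit arguments are closed
  -- checks that evaluate to ⊤, so they are discharged automatically.
  excluded : ∀ d₁ d₂ d₃ d₄ {Ls} → Ascending 3 (suc n) Ls → ∀ Q {Mp} →
             map (realise (1 ∷ 2 ∷ Ls)) Q ≡ 1 ∷ 2 ∷ Ls ++ 2 ∷ Mp ++ x ∷ 1 ∷ [] → Mp ⊆ M →
             {inRange : True (all? (λ j → (1 ≤? j) ×-dec (j ≤? 2 + length Ls)) Q)} →
             {avoided : T (not (fits (d₁ ∷ d₂ ∷ d₃ ∷ d₄ ∷ []) [] Q))} → ⊥
  excluded d₁ d₂ d₃ d₄ {Ls} asc Q eq σ {inRange} {avoided} =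
    subst T (Equivalence.to T-not-≡ avoided)
      (contained⇒fits ds r (Contains-trans (width4 _ (monotoneFormation-isFormation ds r))
                                           (Contains-image Q (realise L) injective τ)))
    where
    ds = d₁ ∷ d₂ ∷ d₃ ∷ d₄ ∷ []
    L = 1 ∷ 2 ∷ Ls
    L-ascending : Ascending 1 (suc n) L
    L-ascending = s≤s z≤n ∷ ≤-refl ∷ asc
    injective : InjectiveOn (realise L) Q
    injective i∈ j∈ = realise-injective (AllPairs.map <⇒≢ (Ascending⇒AllPairs L-ascending))
                        (All.lookup (toWitness inRange) i∈) (All.lookup (toWitness inRange) j∈)
    τ : map (realise L) Q ⊆ interval 1 n ++ 2 ∷ M ++ x ∷ 1 ∷ []
    τ = subst (_⊆ _) (sym eq) (⊆-++⁺ (Ascending⊆interval n L-ascending) (refl ∷ ⊆-++⁺ σ ⊆-refl))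

  x≢1 : 3 ≤ n → x ≢ 1
  x≢1 3≤n x≡1 =
    excluded ↑ ↓ ↑ ↑ (≤-refl ∷ [] (s≤s 3≤n)) (1 ∷ 2 ∷ 3 ∷ 2 ∷ 3 ∷ 1 ∷ 1 ∷ [])
      (cong (λ z → 1 ∷ 2 ∷ 3 ∷ 2 ∷ 3 ∷ z ∷ 1 ∷ []) (sym x≡1)) (from∈ 3∈M)
    where
    3∈M = M-complete (s≤s z≤n) 3≤n (λ ()) (λ ()) (λ 3≡x → contradiction (trans 3≡x x≡1) λ ())

  module _ (3≤x : 3 ≤ x) (x<n : x < n) where

    ∈M : ∀ {c} → 3 ≤ c → c ≤ n → c ≢ x → c ∈ M
    ∈M 3≤c c≤n = M-complete (<⇒≤ (<⇒≤ 3≤c)) c≤n (>⇒≢ (<⇒≤ 3≤c)) (>⇒≢ 3≤c)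

    n∈M : n ∈ M
    n∈M = ∈M (≤-trans 3≤x (<⇒≤ x<n)) ≤-refl (>⇒≢ x<n)

    x∉M : x ∉ M
    x∉M x∈M = excluded ↑ ↓ ↑ ↑ (3≤x ∷ [] (m≤n⇒m≤1+n x<n))
      (1 ∷ 2 ∷ 3 ∷ 2 ∷ 3 ∷ 3 ∷ 1 ∷ []) refl (from∈ x∈M)

    no-descent : ∀ {y z} → 3 ≤ y → y < z → z ≤ n → y ≢ x → z ≢ x → ¬ z ∷ y ∷ [] ⊆ M
    no-descent {y} {z} 3≤y y<z z≤n′ y≢x z≢x σ with <-cmp x y
    ... | tri≈ _ x≡y _ = y≢x (sym x≡y)
    ... | tri< x<y _ _ =
      excluded ↑ ↑ ↑ ↑ (3≤x ∷ x<y ∷ y<z ∷ [] (s≤s z≤n′))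
        (1 ∷ 2 ∷ 3 ∷ 4 ∷ 5 ∷ 2 ∷ 5 ∷ 4 ∷ 3 ∷ 1 ∷ []) refl σ
    ... | tri> _ _ y<x with <-cmp x z
    ...   | tri≈ _ x≡z _ = z≢x (sym x≡z)
    ...   | tri< x<z _ _ =
      excluded ↑ ↓ ↓ ↑ (3≤y ∷ y<x ∷ x<z ∷ [] (s≤s z≤n′))
        (1 ∷ 2 ∷ 3 ∷ 4 ∷ 5 ∷ 2 ∷ 5 ∷ 3 ∷ 4 ∷ 1 ∷ []) refl σ
    ...   | tri> _ _ z<x with ⊆-insert-pair σ n∈M (>⇒≢ (<-trans z<x x<n)) (>⇒≢ (<-trans y<z (<-trans z<x x<n)))
    ...     | inj₁ ρ =
      excluded ↑ ↓ ↓ ↑ (3≤y ∷ y<z ∷ z<x ∷ x<n ∷ [] ≤-refl)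
        (1 ∷ 2 ∷ 3 ∷ 4 ∷ 5 ∷ 6 ∷ 2 ∷ 6 ∷ 4 ∷ 3 ∷ 5 ∷ 1 ∷ []) refl ρ
    ...     | inj₂ (inj₁ ρ) =
      excluded ↑ ↓ ↓ ↑ (3≤y ∷ y<z ∷ z<x ∷ x<n ∷ [] ≤-refl)
        (1 ∷ 2 ∷ 3 ∷ 4 ∷ 5 ∷ 6 ∷ 2 ∷ 4 ∷ 6 ∷ 3 ∷ 5 ∷ 1 ∷ []) refl ρ
    ...     | inj₂ (inj₂ ρ) =
      excluded ↑ ↑ ↑ ↑ (3≤y ∷ y<z ∷ z<x ∷ x<n ∷ [] ≤-refl)
        (1 ∷ 2 ∷ 3 ∷ 4 ∷ 5 ∷ 6 ∷ 2 ∷ 4 ∷ 3 ∷ 6 ∷ 5 ∷ 1 ∷ []) refl ρ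

    -- y is an auxiliary letter of M below n; no-ababa picks y ∈ {3, 4}.
    module _ {y} (3≤y : 3 ≤ y) (y<n : y < n) (y≢x : y ≢ x) where

      y∈M : y ∈ M
      y∈M = ∈M 3≤y (<⇒≤ y<n) y≢x

      2∉M : 2 ∉ M
      2∉M 2∈M with ⊆-insert-singleton (from∈ y∈M) 2∈M (<⇒≢ 3≤y) | <-cmp x y
      ... | _      | tri≈ _ x≡y _ = y≢x (sym x≡y)
      ... | inj₁ ρ | tri< x<y _ _ =
        excluded ↑ ↑ ↑ ↑ (3≤x ∷ x<y ∷ [] (m≤n⇒m≤1+n y<n))
          (1 ∷ 2 ∷ 3 ∷ 4 ∷ 2 ∷ 2 ∷ 4 ∷ 3 ∷ 1 ∷ []) refl ρ
      ... | inj₂ ρ | tri< x<y _ _ =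
        excluded ↑ ↓ ↓ ↑ (3≤x ∷ x<y ∷ [] (m≤n⇒m≤1+n y<n))
          (1 ∷ 2 ∷ 3 ∷ 4 ∷ 2 ∷ 4 ∷ 2 ∷ 3 ∷ 1 ∷ []) refl ρ
      ... | inj₁ ρ | tri> _ _ y<x =
        excluded ↑ ↓ ↓ ↑ (3≤y ∷ y<x ∷ [] (m≤n⇒m≤1+n x<n))
          (1 ∷ 2 ∷ 3 ∷ 4 ∷ 2 ∷ 2 ∷ 3 ∷ 4 ∷ 1 ∷ []) refl ρ
      ... | inj₂ ρ | tri> _ _ y<x =
        excluded ↑ ↓ ↑ ↑ (3≤y ∷ y<x ∷ [] (m≤n⇒m≤1+n x<n))
          (1 ∷ 2 ∷ 3 ∷ 4 ∷ 2 ∷ 3 ∷ 2 ∷ 4 ∷ 1 ∷ []) refl ρ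

      y-before-n : y ∷ n ∷ [] ⊆ M
      y-before-n with ⊆-insert-singleton (from∈ y∈M) n∈M (>⇒≢ y<n)
      ... | inj₁ ρ = ⊥-elim (no-descent 3≤y y<n ≤-refl y≢x (>⇒≢ x<n) ρ)
      ... | inj₂ ρ = ρ

      1-not-after-y : ¬ y ∷ 1 ∷ [] ⊆ M
      1-not-after-y σ with <-cmp x y
      ... | tri≈ _ x≡y _ = y≢x (sym x≡y)
      ... | tri< x<y _ _ =
        excluded ↑ ↓ ↓ ↑ (3≤x ∷ x<y ∷ [] (m≤n⇒m≤1+n y<n))
          (1 ∷ 2 ∷ 3 ∷ 4 ∷ 2 ∷ 4 ∷ 1 ∷ 3 ∷ 1 ∷ []) refl σ
      ... | tri> _ _ y<x =
        excluded ↑ ↓ ↑ ↑ (3≤y ∷ y<x ∷ [] (m≤n⇒m≤1+n x<n))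
          (1 ∷ 2 ∷ 3 ∷ 4 ∷ 2 ∷ 3 ∷ 1 ∷ 4 ∷ 1 ∷ []) refl σ

      1∉M : 1 ∉ M
      1∉M 1∈M with ⊆-insert-pair y-before-n 1∈M (<⇒≢ (<⇒≤ 3≤y)) (<⇒≢ (<⇒≤ (≤-trans 3≤y (<⇒≤ y<n))))
      ... | inj₂ (inj₁ ρ) = 1-not-after-y (⊆-trans (refl ∷ refl ∷ _ ∷ʳ []) ρ)
      ... | inj₂ (inj₂ ρ) = 1-not-after-y (⊆-trans (refl ∷ _ ∷ʳ refl ∷ []) ρ)
      ... | inj₁ ρ with <-cmp x y
      ...   | tri≈ _ x≡y _ = y≢x (sym x≡y)
      ...   | tri< x<y _ _ =
        excluded ↑ ↑ ↓ ↑ (3≤x ∷ x<y ∷ y<n ∷ [] ≤-refl)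
          (1 ∷ 2 ∷ 3 ∷ 4 ∷ 5 ∷ 2 ∷ 1 ∷ 4 ∷ 5 ∷ 3 ∷ 1 ∷ []) refl ρ
      ...   | tri> _ _ y<x =
        excluded ↑ ↑ ↓ ↑ (3≤y ∷ y<x ∷ x<n ∷ [] ≤-refl)
          (1 ∷ 2 ∷ 3 ∷ 4 ∷ 5 ∷ 2 ∷ 1 ∷ 3 ∷ 5 ∷ 4 ∷ 1 ∷ []) refl ρ

      M-letters : ∀ {c} → c ∈ M → 3 ≤ c × c ≤ n × c ≢ x
      M-letters c∈M with All.lookup M-bounded c∈M
      ... | 1≤c , c≤n =
        ≤∧≢⇒< (≤∧≢⇒< 1≤c λ { refl → 1∉M c∈M }) (λ { refl → 2∉M c∈M }) , c≤n , λ { refl → x∉M c∈M }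

      M-nondecreasing : ∀ {a b} → a ∷ b ∷ [] ⊆ M → a ≤ b
      M-nondecreasing σ with M-letters (lookup σ (here refl)) | M-letters (lookup σ (there (here refl)))
      ... | _ , a≤n , a≢x | 3≤b , _ , b≢x = ≮⇒≥ λ b<a → no-descent 3≤b b<a a≤n b≢x a≢x σ

      suffix-ABAFree : ABAFree (2 ∷ M ++ x ∷ 1 ∷ [])
      suffix-ABAFree =
        ABAFree-++ {xs = [ 2 ]} (short⇒ABAFree (s≤s z≤n))
          (ABAFree-++ (pairwise-≤⇒ABAFree M-nondecreasing) (short⇒ABAFree ≤-refl) M-fresh) 2-fresh
        where
        M-fresh : ∀ {c} → c ∈ M → c ∉ x ∷ 1 ∷ []
        M-fresh c∈M (here refl)         = x∉M c∈M
        M-fresh c∈M (there (here refl)) = 1∉M c∈M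
        2-fresh : ∀ {c} → c ∈ [ 2 ] → c ∉ M ++ x ∷ 1 ∷ []
        2-fresh (here refl) 2∈ with ∈-++⁻ M 2∈
        ... | inj₁ 2∈M                = 2∉M 2∈M
        ... | inj₂ (here 2≡x)         = >⇒≢ 3≤x (sym 2≡x)
        ... | inj₂ (there (here ()))

    no-ababa : 5 ≤ n → ¬ Contains (interval 1 n ++ 2 ∷ M ++ x ∷ 1 ∷ []) ababa
    no-ababa 5≤n with x ≟ 3
    ... | yes x≡3 = no-ababa-in-++ (interval-ABAFree 1 n)
                      (suffix-ABAFree {4} (s≤s (s≤s (s≤s z≤n))) 5≤n λ 4≡x → contradiction (trans 4≡x x≡3) λ ())
    ... | no x≢3  = no-ababa-in-++ (interval-ABAFree 1 n)
                      (suffix-ABAFree {3} ≤-refl (≤-trans (s≤s (s≤s (s≤s (s≤s z≤n)))) 5≤n) (≢-sym x≢3))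

  x≡2⊎x≡n : 5 ≤ n → 1 ≤ x → x ≤ n → Contains (interval 1 n ++ 2 ∷ M ++ x ∷ 1 ∷ []) ababa → x ≡ 2 ⊎ x ≡ n
  x≡2⊎x≡n 5≤n 1≤x x≤n alternates with x ≟ 2 | x ≟ n
  ... | yes x≡2 | _       = inj₁ x≡2
  ... | no _    | yes x≡n = inj₂ x≡n
  ... | no x≢2  | no x≢n  = ⊥-elim (no-ababa 3≤x (≤∧≢⇒< x≤n x≢n) 5≤n alternates)
    where
    3≤x = ≤∧≢⇒< (≤∧≢⇒< 1≤x (≢-sym (x≢1 (≤-trans (s≤s (s≤s (s≤s z≤n))) 5≤n)))) (≢-sym x≢2)

split-at : ∀ n (u : List A) {P c} → take n u ≡ P → head (drop n u) ≡ just c → u ≡ P ++ c ∷ drop (suc n) u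
split-at zero    (c ∷ u) refl refl = refl
split-at (suc n) (a ∷ u) refl h    = cong (a ∷_) (split-at n u refl h)

reverse-++-snoc : ∀ (xs ys : List A) y → reverse (xs ++ ys ++ [ y ]) ≡ y ∷ reverse (xs ++ ys)
reverse-++-snoc xs ys y = trans (cong reverse (sym (++-assoc xs ys [ y ]))) (reverse-++ (xs ++ ys) [ y ])

reverse-++-snoc² : ∀ (xs ys : List A) y z → reverse (xs ++ (ys ++ [ y ]) ++ [ z ]) ≡ z ∷ y ∷ reverse (xs ++ ys)
reverse-++-snoc² xs ys y z = trans (reverse-++-snoc xs (ys ++ [ y ]) z) (cong (z ∷_) (reverse-++-snoc xs ys y))

second-to-last-letter : ∀ n M x → 5 ≤ n → (u : Seq) → u ≡ interval 1 n ++ 2 ∷ M ++ x ∷ 1 ∷ [] →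
  All (λ c → 1 ≤ c × c ≤ n) u → (∀ c → c ∈ u → 2 ≤ occ c u) → (∃ λ r → AllFormationsContain r 4 u) →
  Contains u ababa → x ≡ 2 ⊎ x ≡ n
second-to-last-letter n M x 5≤n _ refl bounded twice (r , width4) alternates =
  LastLetters.x≡2⊎x≡n n M x width4 (++⁻ˡ M suffix-bounded) M-complete 5≤n
    (proj₁ x-bounds) (proj₂ x-bounds) alternates
  where
  suffix-bounded = All.tail (++⁻ʳ (interval 1 n) bounded)
  x-bounds = All.head (++⁻ʳ M suffix-bounded)
  M-complete : ∀ {c} → 1 ≤ c → c ≤ n → c ≢ 1 → c ≢ 2 → c ≢ x → c ∈ M
  M-complete {c} 1≤c c≤n c≢1 c≢2 c≢x
    with second-occurrence (2 ∷ M ++ x ∷ 1 ∷ [])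
           (AllPairs.map <⇒≢ (Ascending⇒AllPairs (interval-ascending 1 n)))
           (twice c (∈-++⁺ˡ (lookup (Ascending⊆interval n (1≤c ∷ [] (s≤s c≤n))) (here refl))))
  ... | here c≡2 = ⊥-elim (c≢2 c≡2)
  ... | there c∈ with ∈-++⁻ M c∈
  ...   | inj₁ c∈M                = c∈M
  ...   | inj₂ (here c≡x)         = ⊥-elim (c≢x c≡x)
  ...   | inj₂ (there (here c≡1)) = ⊥-elim (c≢1 c≡1)

last-letters : ∀ P R → head (reverse (P ++ 2 ∷ R)) ≡ just 1 →
  head (drop 1 (reverse (P ++ 2 ∷ R))) ≡ just 2 ⊎
  ∃₂ λ M x → R ≡ M ++ x ∷ 1 ∷ [] × head (drop 1 (reverse (P ++ 2 ∷ R))) ≡ just x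
last-letters P R last with initLast R
... | [] with () ← trans (sym (cong head (reverse-++-snoc P [] 2))) last
... | R′ ∷ʳ′ a with initLast R′
...   | [] = inj₁ (cong (head ∘ drop 1) (reverse-++-snoc² P [] 2 a))
...   | M ∷ʳ′ x with refl ← trans (sym (cong head (reverse-++-snoc² P (2 ∷ M) x a))) last =
  inj₂ (M , x , ++-assoc M [ x ] [ 1 ] , cong (head ∘ drop 1) (reverse-++-snoc² P (2 ∷ M) x 1))

lemma17 : (n : ℕ) → 6 ≤ n → (u : Seq) →
    All (λ x → 1 ≤ x × x ≤ n) u →
    (∀ x → x ∈ u → 2 ≤ occ x u) →
    FormationWidth u 4 →
    AlternationLength5 u →
    take n u ≡ map suc (upTo n) →
    head (reverse u) ≡ just 1 →
    head (drop n u) ≡ just 2 →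
    (head (drop 1 (reverse u)) ≡ just 2) ⊎ (head (drop 1 (reverse u)) ≡ just n)
lemma17 n 6≤n u bounded twice (width4 , _) (alternates , _) prefix last middle
  with drop (suc n) u | split-at n u prefix middle
... | R | refl with last-letters (map suc (upTo n)) R last
...   | inj₁ second≡2                  = inj₁ second≡2
...   | inj₂ (M , x , refl , second≡x) =
  Sum.map (trans second≡x ∘ cong just) (trans second≡x ∘ cong just)
    (second-to-last-letter n M x (<⇒≤ 6≤n) _ canonical bounded twice width4 alternates)
  where
  canonical : map suc (upTo n) ++ 2 ∷ M ++ x ∷ 1 ∷ [] ≡ interval 1 n ++ 2 ∷ M ++ x ∷ 1 ∷ []
  canonical = cong (_++ 2 ∷ M ++ x ∷ 1 ∷ [])
                   (trans (map-applyUpTo id suc n) (applyUpTo≡interval 1 n λ _ → refl))
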